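{- Let $t$ be a closed term. If $d\colon t\to_{\mathrm{cbn}}^{*} s$ and $\mathrm{normal}(s)$, then there is a tight derivation in the CbN type system of $\vdash^{(|d|_m,|d|_e)} t:\mathsf{normal}$.
   Context: Terms: $t,s ::= x \mid \lambda x.t \mid t\,s \mid t[x\leftarrow s]$, where $t[x\leftarrow s]$ (explicit substitution) binds $x$ in $t$. $\mathrm{fv}(t[x\leftarrow s])=(\mathrm{fv}(t)\setminus\{x\})\cup\mathrm{fv}(s)$; closed means no free variables; terms up to $\alpha$-equivalence. Contexts: substitution contexts $S ::= \langle\cdot\rangle \mid S[x\leftarrow t]$; CbN contexts $C ::= \langle\cdot\rangle \mid C\,t \mid C[x\leftarrow t]$; $C\langle t\rangle$ is plugging (may capture), $C\langle\langle t\rangle\rangle$ plugging where $C$ does not capture free variables of $t$. Root steps: $S\langle\lambda x.t\rangle s\mapsto_m S\langle t[x\leftarrow s]\rangle$ (variables bound by $S$ disjoint from $\mathrm{fv}(s)$); $C\langle\langle x\rangle\rangle[x\leftarrow t]\mapsto_e C\langle\langle t\rangle\rangle[x\leftarrow t]$. $\to_{m,\mathrm{cbn}}$ (resp. $\to_{e,\mathrm{cbn}}$) relates $C\langle t'\rangle$ to $C\langle s'\rangle$ for any CbN context $C$ when $t'\mapsto_m s'$ (resp. $\mapsto_e$); $\to_{\mathrm{cbn}}$ is their union. $|d|_m$, $|d|_e$ count multiplicative and exponential steps of $d$. $\mathrm{normal}$: least predicate with $\mathrm{normal}(\lambda x.t)$ and $\mathrm{normal}(t)\Rightarrow\mathrm{normal}(t[x\leftarrow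 s])$. CbN types: linear types $L ::= \mathsf{normal}\mid M\to L$; multi types $M ::= [L_i]_{i\in J}$ finite multisets, $\mathbf 0$ the empty multiset, $\uplus$ union. Type contexts $\Gamma$ map variables to multi types, all but finitely many to $\mathbf 0$; $\mathrm{dom}(\Gamma)=\{x\mid\Gamma(x)\neq\mathbf 0\}$; empty if domain empty; $\uplus$ pointwise; $\Gamma,x:M$ means $\Gamma\uplus(x\mapsto M)$ with $x\notin\mathrm{dom}(\Gamma)$; $\Gamma\setminus\!\!\setminus x$ is $\Gamma$ with $x$ mapped to $\mathbf 0$. Rules: (ax) $x:[L]\vdash^{(0,1)} x:L$; (normal) $\vdash^{(0,0)}\lambda x.t:\mathsf{normal}$; (fun) from $\Gamma\vdash^{(m,e)} t:L$ infer $\Gamma\setminus\!\!\setminus x\vdash^{(m,e)}\lambda x.t:\Gamma(x)\to L$; (many) from $\Pi_i\vdash^{(m_i,e_i)} t:L_i$ for $i\in J$ ($J$ finite, possibly empty) infer $\biguplus_i\Pi_i\vdash^{(\sum m_i,\sum e_i)} t:[L_i]_{i\in J}$; (app) from $\Gamma\vdash^{(m,e)} t:M\to L$ and $\Pi\vdash^{(m',e')} s:M$ infer $\Gamma\uplus\Pi\vdash^{(m+m'+1,e+e')} t\,s:L$; (ES) from $\Gamma,x:M\vdash^{(m,e)} t:L$ and $\Pi\vdash^{(m',e')} s:M$ infer $\Gamma\uplus\Pi\vdash^{(m+m',e+e')} t[x\leftarrow s]:L$. A derivation of $\Gamma\vdash^{(m,e)} t:L$ is tight if $L=\mathsf{normal}$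 and $\Gamma$ is empty. -}

module Defs where

open import Data.Nat using (ℕ; zero; suc; _+_)
open import Data.Fin using (Fin; zero; suc)
open import Data.List using (List; []; _∷_; _++_)
open import Data.Vec using (Vec; replicate; zipWith) renaming ([] to []ᵥ; _∷_ to _∷ᵥ_)

-- Terms (well-scoped de Bruijn; α-equivalence is syntactic identity)
-- var, λ, application, explicit substitution  t[x←s]  =  esub t s,
-- where t lives in the scope extended by the bound variable (index zero).

data Term (n : ℕ) : Set where
  var  : Fin n → Term n
  lam  : Term (suc n) → Term n
  app  : Term n → Term n → Term n
  esub : Term (suc n) → Term n → Term n

Closed : Set
Closed = Term 0

ext : ∀ {n m} → (Fin n → Fin m) → Fin (suc n) → Fin (suc m)
ext ρ zero    = zero
ext ρ (suc i) = suc (ρ i)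

rename : ∀ {n m} → (Fin n → Fin m) → Term n → Term m
rename ρ (var x)    = var (ρ x)
rename ρ (lam t)    = lam (rename (ext ρ) t)
rename ρ (app t s)  = app (rename ρ t) (rename ρ s)
rename ρ (esub t s) = esub (rename (ext ρ) t) (rename ρ s)

-- Substitution contexts  S ::= ⟨·⟩ | S[x←t]
-- SCtx n m : outer scope n, scope at the hole m.

data SCtx (n : ℕ) : ℕ → Set where
  hole : SCtx n n
  sES  : ∀ {m} → SCtx (suc n) m → Term n → SCtx n m

plugS : ∀ {n m} → SCtx n m → Term m → Term n
plugS hole       t = t
plugS (sES S u)  t = esub (plugS S t) u

-- how outer variables are seen at the hole (weakening past the binders of S)
embS : ∀ {n m} → SCtx n m → Fin n → Fin m
embS hole      i = i
embS (sES S u) i = embS S (suc i)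

data CCtx (n : ℕ) : ℕ → Set where
  hole : CCtx n n
  appL : ∀ {m} → CCtx n m → Term n → CCtx n m
  cES  : ∀ {m} → CCtx (suc n) m → Term n → CCtx n m

plugC : ∀ {n m} → CCtx n m → Term m → Term n
plugC hole       t = t
plugC (appL C u) t = app (plugC C t) u
plugC (cES C u)  t = esub (plugC C t) u

embC : ∀ {n m} → CCtx n m → Fin n → Fin m
embC hole       i = i
embC (appL C u) i = embC C i
embC (cES C u)  i = embC C (suc i)

-- S⟨λx.t⟩ s ↦m S⟨t[x←s]⟩   (s weakened past S: no capture)
data _↦m_ {n : ℕ} : Term n → Term n → Set where
  rootM : ∀ {m} (S : SCtx n m) (t : Term (suc m)) (s : Term n) →
          app (plugS S (lam t)) s ↦m plugS S (esub t (rename (embS S) s))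

-- C⟨⟨x⟩⟩[x←t] ↦e C⟨⟨t⟩⟩[x←t]   (x = index zero of the ES, not captured by C)
data _↦e_ {n : ℕ} : Term n → Term n → Set where
  rootE : ∀ {m} (C : CCtx (suc n) m) (t : Term n) →
          esub (plugC C (var (embC C zero))) t
            ↦e esub (plugC C (rename (λ i → embC C (suc i)) t)) t

data Kind : Set where
  mul expo : Kind

data Step {n : ℕ} : Kind → Term n → Term n → Set where
  stepM : ∀ {m} (C : CCtx n m) {t s : Term m} → t ↦m s → Step mul (plugC C t) (plugC C s)
  stepE : ∀ {m} (C : CCtx n m) {t s : Term m} → t ↦e s → Step expo (plugC C t) (plugC C s)

data _→cbn*_ {n : ℕ} : Term n → Term n → Set where
  done : ∀ {t} → t →cbn* t
  _∷_  : ∀ {k t u s} → Step k t u → u →cbn* s → t →cbn* s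

∣_∣m : ∀ {n} {t s : Term n} → t →cbn* s → ℕ
∣ done ∣m = 0
∣ _∷_ {k = mul}  _ d ∣m = suc ∣ d ∣m
∣ _∷_ {k = expo} _ d ∣m = ∣ d ∣m

∣_∣e : ∀ {n} {t s : Term n} → t →cbn* s → ℕ
∣ done ∣e = 0
∣ _∷_ {k = mul}  _ d ∣e = ∣ d ∣e
∣ _∷_ {k = expo} _ d ∣e = suc ∣ d ∣e

data normal {n : ℕ} : Term n → Set where
  nLam : ∀ {t} → normal (lam t)
  nES  : ∀ {t s} → normal t → normal (esub t s)

-- CbN types.  Multi types are finite multisets, represented by lists and
-- compared up to (nested) permutation via _≈M_.

data LType : Set where
  normalT : LType
  _⇒_     : List LType → LType → LType

MType : Set
MType = List LType

data _≈L_ : LType → LType → Set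
data _≈M_ : MType → MType → Set

data _≈L_ where
  normal≈ : normalT ≈L normalT
  ⇒≈      : ∀ {M M' L L'} → M ≈M M' → L ≈L L' → (M ⇒ L) ≈L (M' ⇒ L')

data _≈M_ where
  []≈    : [] ≈M []
  ∷≈     : ∀ {L L' M M'} → L ≈L L' → M ≈M M' → (L ∷ M) ≈M (L' ∷ M')
  swap≈  : ∀ {L L' M} → (L ∷ L' ∷ M) ≈M (L' ∷ L ∷ M)
  trans≈ : ∀ {M M' M''} → M ≈M M' → M' ≈M M'' → M ≈M M''

TCtx : ℕ → Set
TCtx n = Vec MType n

emptyCtx : (n : ℕ) → TCtx n
emptyCtx n = replicate n []

_⊎_ : ∀ {n} → TCtx n → TCtx n → TCtx n
Γ ⊎ Π = zipWith _++_ Γ Π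

single : ∀ {n} → Fin n → LType → TCtx n
single {suc n} zero    L = (L ∷ []) ∷ᵥ emptyCtx n
single         (suc x) L = [] ∷ᵥ single x L

data _⊢⟨_,_⟩_∶_ {n : ℕ} : TCtx n → ℕ → ℕ → Term n → LType → Set
data _⊢M⟨_,_⟩_∶_ {n : ℕ} : TCtx n → ℕ → ℕ → Term n → MType → Set

data _⊢⟨_,_⟩_∶_ {n} where
  ax     : ∀ (x : Fin n) L → single x L ⊢⟨ 0 , 1 ⟩ var x ∶ L
  normalR : ∀ {t} → emptyCtx n ⊢⟨ 0 , 0 ⟩ lam t ∶ normalT
  fun    : ∀ {M Γ m e t L} → (M ∷ᵥ Γ) ⊢⟨ m , e ⟩ t ∶ L → Γ ⊢⟨ m , e ⟩ lam t ∶ (M ⇒ L)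
  appR   : ∀ {Γ Π m e m' e' t s M M' L} →
           Γ ⊢⟨ m , e ⟩ t ∶ (M ⇒ L) → Π ⊢M⟨ m' , e' ⟩ s ∶ M' → M ≈M M' →
           (Γ ⊎ Π) ⊢⟨ m + m' + 1 , e + e' ⟩ app t s ∶ L
  esR    : ∀ {Γ Π m e m' e' t s M M' L} →
           (M ∷ᵥ Γ) ⊢⟨ m , e ⟩ t ∶ L → Π ⊢M⟨ m' , e' ⟩ s ∶ M' → M ≈M M' →
           (Γ ⊎ Π) ⊢⟨ m + m' , e + e' ⟩ esub t s ∶ L

data _⊢M⟨_,_⟩_∶_ {n} where
  many[] : ∀ {t} → emptyCtx n ⊢M⟨ 0 , 0 ⟩ t ∶ []
  many∷  : ∀ {Γ Π m e m' e' t L M} →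
           Γ ⊢⟨ m , e ⟩ t ∶ L → Π ⊢M⟨ m' , e' ⟩ t ∶ M →
           (Γ ⊎ Π) ⊢M⟨ m + m' , e + e' ⟩ t ∶ (L ∷ M)

Tight : ∀ {n} → ℕ → ℕ → Term n → Set
Tight {n} m e t = emptyCtx n ⊢⟨ m , e ⟩ t ∶ normalT

module Submission where

-- The proof is by subject expansion.  Every CbN normal form has a tight
-- derivation with indices (0,0).  Conversely, if  t → t'  is a CbN step and
-- Γ ⊢(m,e) t' : L, then t has a derivation of the same type in a context that
-- is a permutation of Γ, with m raised by one for a multiplicative step and e
-- raised by one for an exponential step.  Iterating along d : t →* s yields
-- the indices (|d|m , |d|e).  Contexts are only equal up to permutation of
-- their multisets, so we work with the pointwise permutation relation _≋_.

open import Defs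
open import Data.Nat using (ℕ; zero; suc; _+_)
open import Data.Nat.Properties using (+-comm; +-assoc; +-commutativeSemigroup)
open import Data.Nat.Solver using (module +-*-Solver)
open import Data.Fin using (Fin; zero; suc)
open import Data.List using ([]; _∷_; _++_)
open import Data.Vec using () renaming ([] to []ᵥ; _∷_ to _∷ᵥ_)
import Data.Vec.Properties as VecP
open import Data.Vec.Relation.Binary.Pointwise.Inductive as PW using (Pointwise; _∷_)
open import Data.Product using (Σ-syntax; _×_; _,_)
open import Relation.Binary.PropositionalEquality
open import Data.List.Relation.Binary.Permutation.Propositional as Perm
  using (_↭_; prep; swap; ↭-refl; ↭-sym; ↭-trans; ↭-isEquivalence)
import Data.List.Relation.Binary.Permutation.Propositional.Properties as PermP
open import Algebra.Bundles using (CommutativeSemigroup)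
import Algebra.Properties.CommutativeSemigroup as CommSemigroupProps

+-exchange : ∀ a b c → (a + b) + c ≡ (a + c) + b
+-exchange = CommSemigroupProps.xy∙z≈xz∙y +-commutativeSemigroup

+-exchange-app : ∀ a b c → (a + b + 1) + c ≡ (a + c) + b + 1
+-exchange-app = solve 3 (λ a b c → (a :+ b :+ con 1) :+ c := (a :+ c) :+ b :+ con 1) refl
  where open +-*-Solver using (solve; _:+_; _:=_; con)

ext-cong : ∀ {n m} {ρ σ : Fin n → Fin m} → (∀ i → ρ i ≡ σ i) → ∀ i → ext ρ i ≡ ext σ i
ext-cong h zero    = refl
ext-cong h (suc i) = cong suc (h i)

rename-cong : ∀ {n m} {ρ σ : Fin n → Fin m} → (∀ i → ρ i ≡ σ i) → ∀ t → rename ρ t ≡ rename σ t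
rename-cong h (var x)    = cong var (h x)
rename-cong h (lam t)    = cong lam (rename-cong (ext-cong h) t)
rename-cong h (app t s)  = cong₂ app (rename-cong h t) (rename-cong h s)
rename-cong h (esub t s) = cong₂ esub (rename-cong (ext-cong h) t) (rename-cong h s)

ext-fuse : ∀ {n m k} (ρ : Fin m → Fin k) (σ : Fin n → Fin m) →
           ∀ i → ext ρ (ext σ i) ≡ ext (λ j → ρ (σ j)) i
ext-fuse ρ σ zero    = refl
ext-fuse ρ σ (suc i) = refl

rename-fuse : ∀ {n m k} (ρ : Fin m → Fin k) (σ : Fin n → Fin m) t →
              rename ρ (rename σ t) ≡ rename (λ i → ρ (σ i)) t
rename-fuse ρ σ (var x)    = refl
rename-fuse ρ σ (lam t)    =
  cong lam (trans (rename-fuse (ext ρ) (ext σ) t) (rename-cong (ext-fuse ρ σ) t))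
rename-fuse ρ σ (app t s)  = cong₂ app (rename-fuse ρ σ t) (rename-fuse ρ σ s)
rename-fuse ρ σ (esub t s) =
  cong₂ esub (trans (rename-fuse (ext ρ) (ext σ) t) (rename-cong (ext-fuse ρ σ) t))
             (rename-fuse ρ σ s)

ext-id : ∀ {n} {ρ : Fin n → Fin n} → (∀ i → ρ i ≡ i) → ∀ i → ext ρ i ≡ i
ext-id h zero    = refl
ext-id h (suc i) = cong suc (h i)

rename-id : ∀ {n} {ρ : Fin n → Fin n} → (∀ i → ρ i ≡ i) → ∀ t → rename ρ t ≡ t
rename-id h (var x)    = cong var (h x)
rename-id h (lam t)    = cong lam (rename-id (ext-id h) t)
rename-id h (app t s)  = cong₂ app (rename-id h t) (rename-id h s)
rename-id h (esub t s) = cong₂ esub (rename-id (ext-id h) t) (rename-id h s)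

castT : ∀ {n} {Γ : TCtx n} {m e t t' L} → t ≡ t' → Γ ⊢⟨ m , e ⟩ t ∶ L → Γ ⊢⟨ m , e ⟩ t' ∶ L
castT refl D = D

castTM : ∀ {n} {Γ : TCtx n} {m e t t' M} → t ≡ t' → Γ ⊢M⟨ m , e ⟩ t ∶ M → Γ ⊢M⟨ m , e ⟩ t' ∶ M
castTM refl D = D

castN : ∀ {n} {Γ : TCtx n} {m e m' e' t L} → m ≡ m' → e ≡ e' →
        Γ ⊢⟨ m , e ⟩ t ∶ L → Γ ⊢⟨ m' , e' ⟩ t ∶ L
castN refl refl D = D

castΓ : ∀ {n} {Γ Γ' : TCtx n} {m e t L} → Γ ≡ Γ' → Γ ⊢⟨ m , e ⟩ t ∶ L → Γ' ⊢⟨ m , e ⟩ t ∶ L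
castΓ refl D = D

≈L-refl : ∀ L → L ≈L L
≈M-refl : ∀ M → M ≈M M
≈L-refl normalT = normal≈
≈L-refl (M ⇒ L) = ⇒≈ (≈M-refl M) (≈L-refl L)
≈M-refl []      = []≈
≈M-refl (L ∷ M) = ∷≈ (≈L-refl L) (≈M-refl M)

↭⇒≈M : ∀ {M M'} → M ↭ M' → M ≈M M'
↭⇒≈M {M} Perm.refl  = ≈M-refl M
↭⇒≈M (prep L p)     = ∷≈ (≈L-refl L) (↭⇒≈M p)
↭⇒≈M (swap L L' p)  = trans≈ swap≈ (∷≈ (≈L-refl L') (∷≈ (≈L-refl L) (↭⇒≈M p)))
↭⇒≈M (Perm.trans p q) = trans≈ (↭⇒≈M p) (↭⇒≈M q)

-- the entry of a variable in  Γ ⊎ Δ  when Δ does not use it (M ++ [] ↭ M')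
headPerm⇒≈M : ∀ {M M'} → M ++ [] ↭ M' → M ≈M M'
headPerm⇒≈M {M} p = ↭⇒≈M (↭-trans (↭-sym (PermP.++-identityʳ M)) p)

infix 4 _≋_
_≋_ : ∀ {n} → TCtx n → TCtx n → Set
_≋_ = Pointwise _↭_

≋-refl : ∀ {n} {Γ : TCtx n} → Γ ≋ Γ
≋-refl = PW.refl ↭-refl

≋-sym : ∀ {n} {Γ Γ' : TCtx n} → Γ ≋ Γ' → Γ' ≋ Γ
≋-sym = PW.sym ↭-sym

≋-trans : ∀ {n} {Γ Γ' Γ'' : TCtx n} → Γ ≋ Γ' → Γ' ≋ Γ'' → Γ ≋ Γ''
≋-trans = PW.trans ↭-trans

≡⇒≋ : ∀ {n} {Γ Γ' : TCtx n} → Γ ≡ Γ' → Γ ≋ Γ'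
≡⇒≋ refl = ≋-refl

⊎-cong : ∀ {n} {Γ Γ' Π Π' : TCtx n} → Γ ≋ Γ' → Π ≋ Π' → (Γ ⊎ Π) ≋ (Γ' ⊎ Π')
⊎-cong = PW.zipWith-cong PermP.++⁺

ctxCommutativeSemigroup : ℕ → CommutativeSemigroup _ _
ctxCommutativeSemigroup n = record
  { Carrier = TCtx n
  ; _≈_     = _≋_
  ; _∙_     = _⊎_
  ; isCommutativeSemigroup = record
    { isSemigroup = record
      { isMagma = record
        { isEquivalence = PW.isEquivalence ↭-isEquivalence n
        ; ∙-cong        = ⊎-cong
        }
      ; assoc = PW.zipWith-assoc PermP.++-assoc
      }
    ; comm = PW.zipWith-comm PermP.++-comm
    }
  }

⊎-exchange : ∀ {n} (A B C : TCtx n) → ((A ⊎ B) ⊎ C) ≋ ((A ⊎ C) ⊎ B)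
⊎-exchange {n} = CommSemigroupProps.xy∙z≈xz∙y (ctxCommutativeSemigroup n)

⊎-assoc : ∀ {n} (A B C : TCtx n) → ((A ⊎ B) ⊎ C) ≋ (A ⊎ (B ⊎ C))
⊎-assoc = PW.zipWith-assoc PermP.++-assoc

⊎-identityˡ : ∀ {n} (Γ : TCtx n) → (emptyCtx n ⊎ Γ) ≡ Γ
⊎-identityˡ = VecP.zipWith-identityˡ (λ _ → refl)

≋-empty : ∀ {n} {Γ : TCtx n} → Γ ≋ emptyCtx n → Γ ≡ emptyCtx n
≋-empty {Γ = []ᵥ}    PW.[]    = refl
≋-empty {Γ = M ∷ᵥ Γ} (p ∷ ps) = cong₂ _∷ᵥ_ (PermP.↭-empty-inv p) (≋-empty ps)

-- Under an order-preserving embedding θ of n variables into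
-- m, a derivation of the renamed term  rename ⟦ θ ⟧ s  uses only variables in
-- the image of θ: its context is the push-forward of a context for s.

data Thinning : ℕ → ℕ → Set where
  done : Thinning 0 0
  keep : ∀ {n m} → Thinning n m → Thinning (suc n) (suc m)
  skip : ∀ {n m} → Thinning n m → Thinning n (suc m)

⟦_⟧ : ∀ {n m} → Thinning n m → Fin n → Fin m
⟦ keep θ ⟧ zero    = zero
⟦ keep θ ⟧ (suc i) = suc (⟦ θ ⟧ i)
⟦ skip θ ⟧ i       = suc (⟦ θ ⟧ i)

push : ∀ {n m} → Thinning n m → TCtx n → TCtx m
push done     []ᵥ       = []ᵥ
push (keep θ) (M ∷ᵥ Γ)  = M ∷ᵥ push θ Γ
push (skip θ) Γ         = [] ∷ᵥ push θ Γ

identity : ∀ {n} → Thinning n n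
identity {zero}  = done
identity {suc n} = keep identity

⟦identity⟧ : ∀ {n} (i : Fin n) → ⟦ identity ⟧ i ≡ i
⟦identity⟧ zero    = refl
⟦identity⟧ (suc i) = cong suc (⟦identity⟧ i)

push-identity : ∀ {n} (Γ : TCtx n) → push identity Γ ≡ Γ
push-identity []ᵥ      = refl
push-identity (M ∷ᵥ Γ) = cong (M ∷ᵥ_) (push-identity Γ)

push-empty : ∀ {n m} (θ : Thinning n m) → push θ (emptyCtx n) ≡ emptyCtx m
push-empty done     = refl
push-empty (keep θ) = cong ([] ∷ᵥ_) (push-empty θ)
push-empty (skip θ) = cong ([] ∷ᵥ_) (push-empty θ)

push-single : ∀ {n m} (θ : Thinning n m) x L → push θ (single x L) ≡ single (⟦ θ ⟧ x) L
push-single (keep θ) zero    L = cong ((L ∷ []) ∷ᵥ_) (push-empty θ)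
push-single (keep θ) (suc x) L = cong ([] ∷ᵥ_) (push-single θ x L)
push-single (skip θ) x       L = cong ([] ∷ᵥ_) (push-single θ x L)

push-⊎ : ∀ {n m} (θ : Thinning n m) (Γ Π : TCtx n) → push θ (Γ ⊎ Π) ≡ (push θ Γ ⊎ push θ Π)
push-⊎ done     []ᵥ       []ᵥ       = refl
push-⊎ (keep θ) (M ∷ᵥ Γ)  (M' ∷ᵥ Π) = cong ((M ++ M') ∷ᵥ_) (push-⊎ θ Γ Π)
push-⊎ (skip θ) Γ         Π         = cong ([] ∷ᵥ_) (push-⊎ θ Γ Π)

rename-keep : ∀ {n m} (θ : Thinning n m) t → rename (ext ⟦ θ ⟧) t ≡ rename ⟦ keep θ ⟧ t
rename-keep θ = rename-cong ext-keep
  where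
  ext-keep : ∀ i → ext ⟦ θ ⟧ i ≡ ⟦ keep θ ⟧ i
  ext-keep zero    = refl
  ext-keep (suc i) = refl

strengthen : ∀ {n m} (θ : Thinning n m) (s : Term n) {Γ a b L} →
  Γ ⊢⟨ a , b ⟩ rename ⟦ θ ⟧ s ∶ L →
  Σ[ Γ₀ ∈ TCtx n ] (Γ ≡ push θ Γ₀ × Γ₀ ⊢⟨ a , b ⟩ s ∶ L)
strengthenM : ∀ {n m} (θ : Thinning n m) (s : Term n) {Γ a b M} →
  Γ ⊢M⟨ a , b ⟩ rename ⟦ θ ⟧ s ∶ M →
  Σ[ Γ₀ ∈ TCtx n ] (Γ ≡ push θ Γ₀ × Γ₀ ⊢M⟨ a , b ⟩ s ∶ M)
strengthen θ (var x) (ax _ L) = single x L , sym (push-single θ x L) , ax x L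
strengthen θ (lam t) normalR  = emptyCtx _ , sym (push-empty θ) , normalR
strengthen θ (lam t) (fun D)
  with strengthen (keep θ) t (castT (rename-keep θ t) D)
... | M ∷ᵥ Γ₀ , refl , D₀ = Γ₀ , refl , fun D₀
strengthen θ (app t s) (appR D A M≈)
  with strengthen θ t D | strengthenM θ s A
... | Γ₀ , refl , D₀ | Π₀ , refl , A₀ = Γ₀ ⊎ Π₀ , sym (push-⊎ θ Γ₀ Π₀) , appR D₀ A₀ M≈
strengthen θ (esub t s) (esR D A M≈)
  with strengthen (keep θ) t (castT (rename-keep θ t) D) | strengthenM θ s A
... | M ∷ᵥ Γ₀ , refl , D₀ | Π₀ , refl , A₀ = Γ₀ ⊎ Π₀ , sym (push-⊎ θ Γ₀ Π₀) , esR D₀ A₀ M≈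
strengthenM θ s many[] = emptyCtx _ , sym (push-empty θ) , many[]
strengthenM θ s (many∷ D A)
  with strengthen θ s D | strengthenM θ s A
... | Γ₀ , refl , D₀ | Π₀ , refl , A₀ = Γ₀ ⊎ Π₀ , sym (push-⊎ θ Γ₀ Π₀) , many∷ D₀ A₀

rename-suc : ∀ {n} (s : Term n) → rename suc s ≡ rename ⟦ skip identity ⟧ s
rename-suc = rename-cong (λ i → cong suc (sym (⟦identity⟧ i)))

strengthen-suc : ∀ {n} (s : Term n) {Δ : TCtx (suc n)} {a b L} →
  Δ ⊢⟨ a , b ⟩ rename suc s ∶ L → Σ[ Δ₀ ∈ TCtx n ] (Δ ≡ [] ∷ᵥ Δ₀ × Δ₀ ⊢⟨ a , b ⟩ s ∶ L)
strengthen-suc s D with strengthen (skip identity) s (castT (rename-suc s) D)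
... | Δ₀ , refl , D₀ = Δ₀ , cong ([] ∷ᵥ_) (push-identity Δ₀) , D₀

strengthenM-suc : ∀ {n} (s : Term n) {Δ : TCtx (suc n)} {a b M} →
  Δ ⊢M⟨ a , b ⟩ rename suc s ∶ M → Σ[ Δ₀ ∈ TCtx n ] (Δ ≡ [] ∷ᵥ Δ₀ × Δ₀ ⊢M⟨ a , b ⟩ s ∶ M)
strengthenM-suc s D with strengthenM (skip identity) s (castTM (rename-suc s) D)
... | Δ₀ , refl , D₀ = Δ₀ , cong ([] ∷ᵥ_) (push-identity Δ₀) , D₀

-- A derivation of C⟨⟨u⟩⟩ splits into a derivation of C⟨⟨y⟩⟩, in which the
-- occurrence of y receives some linear type Lu, and a derivation of u : Lu.
-- The counts add up, except that the new axiom for y costs one exponential.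

record AntiSubst {p q} (C : CCtx p q) (y : Fin p) (u : Term p)
                 (Γ : TCtx p) (m e : ℕ) (L : LType) : Set where
  constructor split
  field
    {Γ₁ Δ}          : TCtx p
    {m₁ e₁ m₂ e₂}   : ℕ
    Lu              : LType
    around-y        : Γ₁ ⊢⟨ m₁ , e₁ ⟩ plugC C (var (embC C y)) ∶ L
    for-u           : Δ ⊢⟨ m₂ , e₂ ⟩ u ∶ Lu
    contexts        : (Γ₁ ⊎ Δ) ≋ (single y Lu ⊎ Γ)
    mul-count       : m₁ + m₂ ≡ m
    exp-count       : e₁ + e₂ ≡ suc e

anti-substitution : ∀ {p q} (C : CCtx p q) (y : Fin p) (u : Term p) {Γ m e L} →
  Γ ⊢⟨ m , e ⟩ plugC C (rename (embC C) u) ∶ L → AntiSubst C y u Γ m e L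
anti-substitution hole y u {L = L} D =
  split L (ax y L) (castT (rename-id (λ _ → refl) u) D) ≋-refl refl refl
anti-substitution (appL C _) y u (appR {Γ = Γ} {Π = Π} {m' = m'} {e' = e'} D A M≈)
  with anti-substitution C y u D
... | split {Γ₁} {Δ} {m₁} {e₁} {m₂} {e₂} Lu D' Du ctx cm ce =
  split Lu (appR D' A M≈) Du
    (≋-trans (⊎-exchange Γ₁ Π Δ) (≋-trans (⊎-cong ctx ≋-refl) (⊎-assoc _ Γ Π)))
    (trans (+-exchange-app m₁ m' m₂) (cong (λ z → z + m' + 1) cm))
    (trans (+-exchange e₁ e' e₂) (cong (_+ e') ce))
anti-substitution (cES C _) y u (esR {Γ = Γ} {Π = Π} {m' = m'} {e' = e'} D A M≈)
  with anti-substitution C (suc y) (rename suc u)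
         (castT (cong (plugC C) (sym (rename-fuse (embC C) suc u))) D)
... | split {Mx ∷ᵥ Γx} {_} {m₁} {e₁} {m₂} {e₂} Lu D' Du ctx cm ce
  with strengthen-suc u Du
... | Δ₀ , refl , Du₀ =
  split Lu (esR D' A (trans≈ (headPerm⇒≈M (PW.head ctx)) M≈)) Du₀
    (≋-trans (⊎-exchange Γx Π Δ₀) (≋-trans (⊎-cong (PW.tail ctx) ≋-refl) (⊎-assoc _ Γ Π)))
    (trans (+-exchange m₁ m' m₂) (cong (_+ m') cm))
    (trans (+-exchange e₁ e' e₂) (cong (_+ e') ce))

tickM : Kind → ℕ → ℕ
tickM mul  m = suc m
tickM expo m = m

tickE : Kind → ℕ → ℕ
tickE mul  e = e
tickE expo e = suc e

tickM-+ : ∀ k a b → tickM k a + b ≡ tickM k (a + b)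
tickM-+ mul  a b = refl
tickM-+ expo a b = refl

tickE-+ : ∀ k a b → tickE k a + b ≡ tickE k (a + b)
tickE-+ mul  a b = refl
tickE-+ expo a b = refl

Expands : ∀ {n} → Kind → Term n → Term n → Set
Expands {n} k a b = ∀ {Γ m e L} → Γ ⊢⟨ m , e ⟩ b ∶ L →
  Σ[ Γ' ∈ TCtx n ] (Γ' ≋ Γ × Γ' ⊢⟨ tickM k m , tickE k e ⟩ a ∶ L)

-- exponential root step: the substituted copy of t becomes one more
-- element of the multi type of t in the explicit substitution
rootE-expands : ∀ {n q} (C : CCtx (suc n) q) (t : Term n) →
  Expands expo (esub (plugC C (var (embC C zero))) t)
               (esub (plugC C (rename (λ i → embC C (suc i)) t)) t)
rootE-expands C t (esR {Γ = Γ} {Π = Π} {m' = mt} {e' = et} D A M≈)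
  with anti-substitution C zero (rename suc t)
         (castT (cong (plugC C) (sym (rename-fuse (embC C) suc t))) D)
... | split {Mx ∷ᵥ Γx} {_} {m₁} {e₁} {m₂} {e₂} Lu D' Du ctx cm ce
  with strengthen-suc t Du
... | Δ₀ , refl , Du₀ =
  Γx ⊎ (Δ₀ ⊎ Π) ,
  ≋-trans (≋-sym (⊎-assoc Γx Δ₀ Π))
          (⊎-cong (≋-trans (PW.tail ctx) (≡⇒≋ (⊎-identityˡ Γ))) ≋-refl) ,
  castN (trans (sym (+-assoc m₁ m₂ mt)) (cong (_+ mt) cm))
        (trans (sym (+-assoc e₁ e₂ et)) (cong (_+ et) ce))
        (esR D' (many∷ Du₀ A) (trans≈ (headPerm⇒≈M (PW.head ctx)) (∷≈ (≈L-refl Lu) M≈)))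

-- Multiplicative root step.  A derivation of S⟨t[x←s]⟩ splits into one of S⟨λx.t⟩ : M ⇒ L and one of
-- s : M' with M ≈M M', i.e. exactly the premises of an application rule.
record MulSplit {n q} (S : SCtx n q) (t : Term (suc q)) (s : Term n)
                (Γ : TCtx n) (m e : ℕ) (L : LType) : Set where
  constructor split
  field
    {Γf Πs}         : TCtx n
    {mf ef ms es}   : ℕ
    {M M'}          : MType
    for-abstraction : Γf ⊢⟨ mf , ef ⟩ plugS S (lam t) ∶ (M ⇒ L)
    for-argument    : Πs ⊢M⟨ ms , es ⟩ s ∶ M'
    M≈M'            : M ≈M M'
    contexts        : (Γf ⊎ Πs) ≋ Γ
    mul-count       : mf + ms ≡ m
    exp-count       : ef + es ≡ e

mul-split : ∀ {n q} (S : SCtx n q) t s {Γ m e L} →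
  Γ ⊢⟨ m , e ⟩ plugS S (esub t (rename (embS S) s)) ∶ L → MulSplit S t s Γ m e L
mul-split hole t s (esR D A M≈) =
  split (fun D) (castTM (rename-id (λ _ → refl) s) A) M≈ ≋-refl refl refl
mul-split (sES S u) t s (esR {Π = Πu} {m' = mu} {e' = eu} D Au Mu≈)
  with mul-split S t (rename suc s)
         (castT (cong (λ z → plugS S (esub t z)) (sym (rename-fuse (embS S) suc s))) D)
... | split {Ma ∷ᵥ Γa} {_} {mf} {ef} {ms} {es} Df As M≈ ctx cm ce
  with strengthenM-suc s As
... | Π₀ , refl , As₀ =
  split (esR Df Au (trans≈ (headPerm⇒≈M (PW.head ctx)) Mu≈)) As₀ M≈
    (≋-trans (⊎-exchange Γa Πu Π₀) (⊎-cong (PW.tail ctx) ≋-refl))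
    (trans (+-exchange mf mu ms) (cong (_+ mu) cm))
    (trans (+-exchange ef eu es) (cong (_+ eu) ce))

rootM-expands : ∀ {n q} (S : SCtx n q) t s →
  Expands mul (app (plugS S (lam t)) s) (plugS S (esub t (rename (embS S) s)))
rootM-expands S t s D with mul-split S t s D
... | split {Γf} {Πs} {mf} {_} {ms} Df As M≈ ctx cm ce =
  Γf ⊎ Πs , ctx , castN (trans (+-comm (mf + ms) 1) (cong suc cm)) ce (appR Df As M≈)

plug-expands : ∀ {n q} k (C : CCtx n q) {a b} → Expands k a b → Expands k (plugC C a) (plugC C b)
plug-expands k hole h D = h D
plug-expands k (appL C _) h (appR {Π = Π} {m = m} {e = e} {m' = m'} {e' = e'} D A M≈)
  with plug-expands k C h D
... | Γ' , Γ'≋ , D' =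
  Γ' ⊎ Π , ⊎-cong Γ'≋ ≋-refl ,
  castN (trans (cong (_+ 1) (tickM-+ k m m')) (tickM-+ k (m + m') 1)) (tickE-+ k e e')
        (appR D' A M≈)
plug-expands k (cES C _) h (esR {Π = Π} {m = m} {e = e} {m' = m'} {e' = e'} D A M≈)
  with plug-expands k C h D
... | _ ∷ᵥ Γ' , p ∷ Γ'≋ , D' =
  Γ' ⊎ Π , ⊎-cong Γ'≋ ≋-refl ,
  castN (tickM-+ k m m') (tickE-+ k e e') (esR D' A (trans≈ (↭⇒≈M p) M≈))

step-expands : ∀ {n k} {a b : Term n} → Step k a b → Expands k a b
step-expands (stepM C (rootM S t s)) = plug-expands mul C (rootM-expands S t s)
step-expands (stepE C (rootE C' t))  = plug-expands expo C (rootE-expands C' t)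

normal-tight : ∀ {n} {s : Term n} → normal s → Tight 0 0 s
normal-tight nLam     = normalR
normal-tight {n} (nES N) = castΓ (⊎-identityˡ (emptyCtx n)) (esR (normal-tight N) many[] []≈)

-- a step of kind k in front of a tight term adds its cost to the indices;
-- tightness is kept because only the empty context is equivalent to it
tight-expansion : ∀ {n k} {a b : Term n} {m e} →
  Step k a b → Tight m e b → Tight (tickM k m) (tickE k e) a
tight-expansion st D with step-expands st D
... | Γ' , Γ'≋ , D' = castΓ (≋-empty Γ'≋) D'

-- the theorem for terms with any number of free variables
normalising⇒tight : ∀ {n} {t s : Term n} (d : t →cbn* s) → normal s → Tight ∣ d ∣m ∣ d ∣e t
normalising⇒tight done                   N = normal-tight N
normalising⇒tight (_∷_ {k = mul}  st d) N = tight-expansion st (normalising⇒tight d N)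
normalising⇒tight (_∷_ {k = expo} st d) N = tight-expansion st (normalising⇒tight d N)

theorem2 : (t s : Closed) (d : t →cbn* s) → normal s →
    Tight ∣ d ∣m ∣ d ∣e t
theorem2 t s d = normalising⇒tight d
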